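{- Let $V$ be a finite set with $n=|V|$, $d$ a nonnegative integer, and $f:2^V\to\{0,1,\dots,d\}$ a posimodular function with $f(\emptyset)=0$, such that every maximal maximizer $X^*$ of $f$ satisfies $|X^*|=n-d$ and $f(X^*)=d$. Let $S$ be a maximizer of $f$ with $|S|=d$, and let $X\subseteq V$ satisfy $|X|=f(X)=d-1$ and $X\cap S=\emptyset$. Then there exists an element $v\in V\setminus(S\cup X)$ with $f(X\cup\{v\})=d$.
   Context: A set function $f:2^V\to\mathbb{R}$ is posimodular if $f(X)+f(Y)\ge f(X\setminus Y)+f(Y\setminus X)$ for all $X,Y\subseteq V$. A maximizer of $f$ is a subset $S\subseteq V$ with $f(S)=\max\{f(X)\mid X\subseteq V\}$; it is a maximal maximizer if no proper superset of $S$ is a maximizer of $f$. -}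

module Defs where

open import Data.Nat using (ℕ; _+_; _≤_)
open import Data.Fin.Subset using (Subset; _─_; _⊂_)
open import Data.Product using (_×_)

Posimodular : ∀ {n} → (Subset n → ℕ) → Set
Posimodular f = ∀ X Y → f (X ─ Y) + f (Y ─ X) ≤ f X + f Y

IsMaximizer : ∀ {n} → (Subset n → ℕ) → Subset n → Set
IsMaximizer f S = ∀ X → f X ≤ f S

IsMaximalMaximizer : ∀ {n} → (Subset n → ℕ) → Subset n → Set
IsMaximalMaximizer f S = IsMaximizer f S × (∀ T → S ⊂ T → IsMaximizer f T → Data.Empty.⊥)
  where import Data.Empty

-- Posimodularity applied to X ∪ {v} and a set U ⊆ ∁X containing v gives
-- f(X) + f(U - v) ≤ f(X ∪ {v}) + f(U): a gain from removing v from U is a gain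
-- from adding v to X, which lifts f(X) = d - 1 to d. If no such gain occurs on
-- any chain from ∁X down to S (removing elements outside S), then f does not
-- decrease on the way back up, so ∁X is a maximizer like S. But ∁X has
-- n - d + 1 elements, more than any maximal maximizer.
module Submission where

open import Defs
open import Data.Nat using (ℕ; suc; s≤s; z≤n; _≤_; _<_; _+_; _∸_; _≤?_)
open import Data.Nat.Properties
  using (≤-trans; ≤-antisym; ≰⇒>; <⇒≱; +-suc; +-monoʳ-≤; +-cancelʳ-≤; ∸-monoʳ-<; m∸n≤m; n<1+n; module ≤-Reasoning)
open import Data.Nat.Induction using (<-rec)
open import Data.Fin using (Fin)
open import Data.Fin.Subset
  using (Subset; ⊥; ∣_∣; _∩_; _∪_; _─_; _-_; ∁; ⁅_⁆; _∈_; _∉_; _⊆_; outside)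
open import Data.Fin.Subset.Properties
open import Data.Vec using (_∷_; here; there)
open import Data.Product using (Σ; ∃; ∃₂; _×_; _,_; proj₁)
open import Data.Sum using (_⊎_; inj₁; inj₂; [_,_]′)
open import Function using (_∘_)
open import Relation.Nullary using (yes; no; contradiction)
open import Relation.Nullary.Decidable using (map′; ¬?; decidable-stable; _×-dec_)
open import Relation.Unary using (Decidable)
open import Relation.Binary.PropositionalEquality using (_≡_; refl; sym; trans; cong; cong₂; subst; subst₂; module ≡-Reasoning)

private variable n : ℕ

x∈p─q⇒x∉q : ∀ {x : Fin n} (p q : Subset n) → x ∈ p ─ q → x ∉ q
x∈p─q⇒x∉q (_ ∷ p) (outside ∷ q) here          ()
x∈p─q⇒x∉q (_ ∷ p) (_       ∷ q) (there x∈p─q) (there x∈q) = x∈p─q⇒x∉q p q x∈p─q x∈q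

p∩q≡⊥⇒q⊆∁p : ∀ {p q : Subset n} → p ∩ q ≡ ⊥ → q ⊆ ∁ p
p∩q≡⊥⇒q⊆∁p {p = p} {q} p∩q≡⊥ {x} x∈q with x ∈? p
... | yes x∈p = contradiction (subst (x ∈_) p∩q≡⊥ (x∈p∩q⁺ (x∈p , x∈q))) ∉⊥
... | no  x∉p = x∉p⇒x∈∁p x∉p

p⊆∁q⇒p─q≡p : ∀ {p q : Subset n} → p ⊆ ∁ q → p ─ q ≡ p
p⊆∁q⇒p─q≡p {p = p} {q} p⊆∁q =
  ⊆-antisym (p─q⊆p p q) (λ x∈p → x∈p∧x∉q⇒x∈p─q x∈p (x∈∁p⇒x∉p (p⊆∁q x∈p)))

p⊆∁q⇒p─[q∪⁅x⁆]≡p-x : ∀ {p q : Subset n} x → p ⊆ ∁ q → p ─ (q ∪ ⁅ x ⁆) ≡ p - x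
p⊆∁q⇒p─[q∪⁅x⁆]≡p-x {p = p} {q} x p⊆∁q = begin
  p ─ (q ∪ ⁅ x ⁆)  ≡⟨ sym (p─q─r≡p─q∪r p q ⁅ x ⁆) ⟩
  p ─ q - x        ≡⟨ cong (_- x) (p⊆∁q⇒p─q≡p p⊆∁q) ⟩
  p - x            ∎
  where open ≡-Reasoning

x∈q⊆∁p⇒[p∪⁅x⁆]─q≡p : ∀ {p q : Subset n} {x} → x ∈ q → q ⊆ ∁ p → (p ∪ ⁅ x ⁆) ─ q ≡ p
x∈q⊆∁p⇒[p∪⁅x⁆]─q≡p {p = p} {q} {x} x∈q q⊆∁p = ⊆-antisym ⊆p p⊆
  where
  ⊆p : (p ∪ ⁅ x ⁆) ─ q ⊆ p
  ⊆p {y} y∈ with x∈p∪q⁻ p ⁅ x ⁆ (p─q⊆p _ q y∈)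
  ... | inj₁ y∈p = y∈p
  ... | inj₂ y∈⁅x⁆ = contradiction (subst (_∈ q) (sym (x∈⁅y⁆⇒x≡y x y∈⁅x⁆)) x∈q) (x∈p─q⇒x∉q _ q y∈)
  p⊆ : p ⊆ (p ∪ ⁅ x ⁆) ─ q
  p⊆ y∈p = x∈p∧x∉q⇒x∈p─q (p⊆p∪q ⁅ x ⁆ y∈p) (x∈p⇒x∉∁p y∈p ∘ q⊆∁p)

module _ {n : ℕ} (f : Subset n → ℕ) where

  GainfulRemoval : Subset n → Subset n → Set
  GainfulRemoval S T = ∃₂ λ U v → U ⊆ T × v ∈ U ─ S × f U < f (U - v)

  maximizer⊆⇒maximizer⊎gainfulRemoval : ∀ {S} → IsMaximizer f S →
    ∀ T → S ⊆ T → IsMaximizer f T ⊎ GainfulRemoval S T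
  maximizer⊆⇒maximizer⊎gainfulRemoval {S} maxS T = <-rec P step ∣ T ─ S ∣ T refl
    where
    P : ℕ → Set
    P k = ∀ T → ∣ T ─ S ∣ ≡ k → S ⊆ T → IsMaximizer f T ⊎ GainfulRemoval S T

    step : ∀ k → (∀ {j} → j < k → P j) → P k
    step _ rec T refl S⊆T with nonempty? (T ─ S)
    ... | no T─S≡∅ = inj₁ (subst (IsMaximizer f) (⊆-antisym S⊆T T⊆S) maxS)
      where
      T⊆S : T ⊆ S
      T⊆S {x} x∈T with x ∈? S
      ... | yes x∈S = x∈S
      ... | no  x∉S = contradiction (x , x∈p∧x∉q⇒x∈p─q x∈T x∉S) T─S≡∅
    ... | yes (v , v∈T─S) with rec smaller (T - v) refl S⊆T-v
      where
      smaller : ∣ T - v ─ S ∣ < ∣ T ─ S ∣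
      smaller = subst (λ U → ∣ U ∣ < ∣ T ─ S ∣) (p─q─r≡p─r─q T S ⁅ v ⁆) (x∈p⇒∣p-x∣<∣p∣ v∈T─S)
      S⊆T-v : S ⊆ T - v
      S⊆T-v x∈S = x∈p∧x≢y⇒x∈p-y (S⊆T x∈S) λ { refl → x∈p─q⇒x∉q T S v∈T─S x∈S }
    ... | inj₂ (U , w , U⊆T-v , gain) = inj₂ (U , w , p─q⊆p T ⁅ v ⁆ ∘ U⊆T-v , gain)
    ... | inj₁ maxT-v with f (T - v) ≤? f T
    ...   | yes f[T-v]≤fT = inj₁ (λ Y → ≤-trans (maxT-v Y) f[T-v]≤fT)
    ...   | no  f[T-v]≰fT = inj₂ (T , v , ⊆-refl , v∈T─S , ≰⇒> f[T-v]≰fT)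

  isMaximizer? : Decidable (IsMaximizer f)
  isMaximizer? T = map′
    (λ noBetter Y → decidable-stable (f Y ≤? f T) (noBetter ∘ (Y ,_)))
    (λ maxT (Y , fY≰fT) → fY≰fT (maxT Y))
    (¬? (anySubset? (λ Y → ¬? (f Y ≤? f T))))

  maximizer⇒⊆maximalMaximizer : ∀ {T} → IsMaximizer f T →
    ∃ λ M → T ⊆ M × IsMaximalMaximizer f M
  maximizer⇒⊆maximalMaximizer {T} = <-rec P step (n ∸ ∣ T ∣) T refl
    where
    P : ℕ → Set
    P k = ∀ T → n ∸ ∣ T ∣ ≡ k → IsMaximizer f T → ∃ λ M → T ⊆ M × IsMaximalMaximizer f M

    step : ∀ k → (∀ {j} → j < k → P j) → P k
    step _ rec T refl maxT with anySubset? (λ T′ → (T ⊂? T′) ×-dec isMaximizer? T′)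
    ... | no noLarger = T , ⊆-refl , maxT , λ T′ T⊂T′ maxT′ → noLarger (T′ , T⊂T′ , maxT′)
    ... | yes (T′ , T⊂T′ , maxT′) with rec (∸-monoʳ-< (p⊂q⇒∣p∣<∣q∣ T⊂T′) (∣p∣≤n T′)) T′ refl maxT′
    ...   | M , T′⊆M , maximalM = M , T′⊆M ∘ proj₁ T⊂T′ , maximalM

  maximizer⇒∣∣≤ : ∀ {k T} → (∀ M → IsMaximalMaximizer f M → ∣ M ∣ ≡ k) →
    IsMaximizer f T → ∣ T ∣ ≤ k
  maximizer⇒∣∣≤ ∣maximal∣≡k maxT with maximizer⇒⊆maximalMaximizer maxT
  ... | M , T⊆M , maximalM = subst (_ ≤_) (∣maximal∣≡k M maximalM) (p⊆q⇒∣p∣≤∣q∣ T⊆M)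

  posimodular-gain : Posimodular f → ∀ {X U v} → v ∈ U → U ⊆ ∁ X →
    f U < f (U - v) → f X < f (X ∪ ⁅ v ⁆)
  posimodular-gain posi {X} {U} {v} v∈U U⊆∁X gain = +-cancelʳ-≤ (f U) (suc (f X)) _ (begin
    suc (f X) + f U          ≡⟨ sym (+-suc (f X) (f U)) ⟩
    f X + suc (f U)          ≤⟨ +-monoʳ-≤ (f X) gain ⟩
    f X + f (U - v)          ≡⟨ cong₂ (λ A B → f A + f B) [X∪v]─U≡X U─[X∪v]≡U-v ⟨
    f ((X ∪ ⁅ v ⁆) ─ U) + f (U ─ (X ∪ ⁅ v ⁆))  ≤⟨ posi (X ∪ ⁅ v ⁆) U ⟩
    f (X ∪ ⁅ v ⁆) + f U      ∎)
    where
    open ≤-Reasoning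
    [X∪v]─U≡X : (X ∪ ⁅ v ⁆) ─ U ≡ X
    [X∪v]─U≡X = x∈q⊆∁p⇒[p∪⁅x⁆]─q≡p v∈U U⊆∁X
    U─[X∪v]≡U-v : U ─ (X ∪ ⁅ v ⁆) ≡ U - v
    U─[X∪v]≡U-v = p⊆∁q⇒p─[q∪⁅x⁆]≡p-x v U⊆∁X

lemma16 : (n d : ℕ) (f : Subset n → ℕ)
    → 1 ≤ d
    → (∀ X → f X ≤ d)
    → Posimodular f
    → f ⊥ ≡ 0
    → (∀ Xs → IsMaximalMaximizer f Xs → (∣ Xs ∣ ≡ n ∸ d) × (f Xs ≡ d))
    → (S : Subset n) → IsMaximizer f S → ∣ S ∣ ≡ d
    → (X : Subset n) → ∣ X ∣ ≡ d ∸ 1 → f X ≡ d ∸ 1 → X ∩ S ≡ ⊥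
    → Σ (Fin n) (λ v → (v ∉ S ∪ X) × (f (X ∪ ⁅ v ⁆) ≡ d))
-- Neither f ⊥ ≡ 0 nor the value f(X*) = d of maximal maximizers is needed.
lemma16 n (suc e) f (s≤s z≤n) f≤d posi _ maximal S maxS ∣S∣≡d X ∣X∣≡e fX≡e X∩S≡⊥ =
  [ ∁X-not-maximizer , augment ]′ (maximizer⊆⇒maximizer⊎gainfulRemoval f maxS (∁ X) S⊆∁X)
  where
  S⊆∁X : S ⊆ ∁ X
  S⊆∁X = p∩q≡⊥⇒q⊆∁p X∩S≡⊥

  ∣∁X∣≡n∸e : ∣ ∁ X ∣ ≡ n ∸ e
  ∣∁X∣≡n∸e = trans (∣∁p∣≡n∸∣p∣ X) (cong (n ∸_) ∣X∣≡e)

  n∸d<∣∁X∣ : n ∸ suc e < ∣ ∁ X ∣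
  n∸d<∣∁X∣ = subst (n ∸ suc e <_) (sym ∣∁X∣≡n∸e) (∸-monoʳ-< (n<1+n e) (≤-trans d≤n∸e (m∸n≤m n e)))
    where
    d≤n∸e : suc e ≤ n ∸ e
    d≤n∸e = subst₂ _≤_ ∣S∣≡d ∣∁X∣≡n∸e (p⊆q⇒∣p∣≤∣q∣ S⊆∁X)

  Goal : Set
  Goal = Σ (Fin n) (λ v → (v ∉ S ∪ X) × (f (X ∪ ⁅ v ⁆) ≡ suc e))

  ∁X-not-maximizer : IsMaximizer f (∁ X) → Goal
  ∁X-not-maximizer max∁X =
    contradiction (maximizer⇒∣∣≤ f (λ M → proj₁ ∘ maximal M) max∁X) (<⇒≱ n∸d<∣∁X∣)

  augment : GainfulRemoval f S (∁ X) → Goal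
  augment (U , v , U⊆∁X , v∈U─S , gain) = v , v∉S∪X , ≤-antisym (f≤d _) d≤f[X∪v]
    where
    v∈U : v ∈ U
    v∈U = p─q⊆p U S v∈U─S
    v∉S∪X : v ∉ S ∪ X
    v∉S∪X = [ x∈p─q⇒x∉q U S v∈U─S , x∈∁p⇒x∉p (U⊆∁X v∈U) ]′ ∘ x∈p∪q⁻ S X
    d≤f[X∪v] : suc e ≤ f (X ∪ ⁅ v ⁆)
    d≤f[X∪v] = subst (λ a → suc a ≤ _) fX≡e (posimodular-gain f posi v∈U U⊆∁X gain)
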